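{- Let $\mathcal{M}$ be a dependence epistemic model, $s\in S$, let $\mathcal{P}$ be either $\mathcal{P}_g$ or $\mathcal{P}_l$, and let $W\subseteq\mathbb{V}$ be nonempty finite. Then $W$ is generative from $\mathcal{P}(s)$ iff: if $|W|=1$, then $W\in\mathcal{P}(s)$; and if $|W|\geq 2$, then for every nonempty $Z\subsetneq W$ there exists $W'\in\mathcal{P}(s)$ such that $W'$ is an evidence of $\langle Z,W\setminus Z\rangle$.
   Context: Fix a countable set $\mathbb{P}$ of propositions and a countable set $\mathbb{V}$ of variables. A dependence epistemic model is $\mathcal{M}=\langle S,T,V,U,\sim_i,\approx\rangle$ where $S$ is a set of worlds, $T:S\times\mathbb{P}\to\{0,1\}$, $V\supseteq\mathbb{V}$ is a countable set of variables, $U:S\times V\to\mathbb{N}$, and $\sim_i,\approx$ are equivalence relations on $S$. For $X\subseteq V$, $X_u=X_v$ means $U(u,x)=U(v,x)$ for all $x\in X$. For $u,v\in S$, $\Delta(u,v)=\{x\in\mathbb{V}\mid U(u,x)\neq U(v,x)\}$ if $(V\setminus\mathbb{V})_u=(V\setminus\mathbb{V})_v$, and $\Delta(u,v)=\emptyset$ otherwise. $W$ is an evidence of $\langle X,Y\rangle$ iff $W\cap X\neq\emptyset$, $W\cap Y\neq\emptyset$, $W\subseteq X\cup Y$. $\mathcal{P}_g(s)=\{\Delta(u,v)\mid u,v\in S,\ u\approx v\approx s,\ \Delta(u,v)\text{ nonempty finite}\}$ and $\mathcal{P}_l(s)=\{\Delta(t,s)\mid t\in S,\ t\approx s,\ \Delta(t,s)\text{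 nonempty finite}\}$. A nonempty finite $W\subseteq\mathbb{V}$ is generative from $\mathcal{P}(s)$ iff for all finite $X,Y\subseteq\mathbb{V}$ such that $W$ is an evidence of $\langle X,Y\rangle$, there is $W'\in\mathcal{P}(s)$ that is also an evidence of $\langle X,Y\rangle$. -}

module Defs where

open import Data.Nat using (ℕ; _≤_)
open import Data.Bool using (Bool)
open import Data.Sum using (_⊎_; inj₁; inj₂)
open import Data.Product using (Σ; _×_; _,_; Σ-syntax)
open import Data.List using (List; length)
open import Data.List.Membership.Propositional using (_∈_; _∉_)
open import Data.List.Relation.Binary.Subset.Propositional using (_⊆_)
open import Relation.Binary.PropositionalEquality using (_≡_; _≢_)
open import Relation.Binary.Structures using (IsEquivalence)
open import Relation.Binary.Core using (Rel)
open import Relation.Nullary using (¬_)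
open import Function.Definitions using (Injective)
open import Function.Bundles using (_⇔_)

Countable : Set → Set
Countable A = Σ (A → ℕ) λ f → Injective _≡_ _≡_ f

VSet : Set → Set₁
VSet 𝕍 = 𝕍 → Set

⟦_⟧ : {𝕍 : Set} → List 𝕍 → VSet 𝕍
⟦ xs ⟧ x = x ∈ xs

-- Dependence epistemic model over propositions ℙ and variables 𝕍.
-- The variable set V ⊇ 𝕍 is represented as 𝕍 ⊎ E, with E = V ∖ 𝕍.
record DEM (ℙ 𝕍 : Set) : Set₁ where
  field
    S     : Set
    T     : S → ℙ → Bool
    E     : Set
    E-countable : Countable E
    U     : S → (𝕍 ⊎ E) → ℕ
    Agent : Set
    _∼[_]_ : S → Agent → S → Set
    ∼-equiv : (i : Agent) → IsEquivalence (λ u v → u ∼[ i ] v)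
    _≈_   : Rel S _
    ≈-equiv : IsEquivalence _≈_

module _ {ℙ 𝕍 : Set} (M : DEM ℙ 𝕍) where
  open DEM M

  Δ : S → S → VSet 𝕍
  Δ u v x = ((e : E) → U u (inj₂ e) ≡ U v (inj₂ e)) × (U u (inj₁ x) ≢ U v (inj₁ x))

_≐_ : {𝕍 : Set} → VSet 𝕍 → VSet 𝕍 → Set
A ≐ B = ∀ x → A x ⇔ B x

NonemptyFinite : {𝕍 : Set} → VSet 𝕍 → Set
NonemptyFinite {𝕍} A = (Σ[ x ∈ 𝕍 ] A x) × (Σ[ xs ∈ List 𝕍 ] (A ≐ ⟦ xs ⟧))

Evidence : {𝕍 : Set} → VSet 𝕍 → VSet 𝕍 → VSet 𝕍 → Set
Evidence {𝕍} W X Y =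
  (Σ[ x ∈ 𝕍 ] (W x × X x)) × (Σ[ y ∈ 𝕍 ] (W y × Y y)) × (∀ z → W z → X z ⊎ Y z)

data Kind : Set where
  global local : Kind

InP : {ℙ 𝕍 : Set} (M : DEM ℙ 𝕍) → Kind → DEM.S M → VSet 𝕍 → Set
InP M global s A =
  Σ[ u ∈ S ] Σ[ v ∈ S ] (u ≈ v) × (v ≈ s) × NonemptyFinite (Δ M u v) × (Δ M u v ≐ A)
  where open DEM M
InP M local s A =
  Σ[ t ∈ S ] (t ≈ s) × NonemptyFinite (Δ M t s) × (Δ M t s ≐ A)
  where open DEM M

Generative : {ℙ 𝕍 : Set} (M : DEM ℙ 𝕍) → Kind → DEM.S M → List 𝕍 → Set₁
Generative {𝕍 = 𝕍} M k s W =
  (X Y : List 𝕍) → Evidence ⟦ W ⟧ ⟦ X ⟧ ⟦ Y ⟧ →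
  Σ[ W' ∈ VSet 𝕍 ] (InP M k s W' × Evidence W' ⟦ X ⟧ ⟦ Y ⟧)

-- The right-hand side characterisation (|W| = length W for duplicate-free W).
Characterisation : {ℙ 𝕍 : Set} (M : DEM ℙ 𝕍) → Kind → DEM.S M → List 𝕍 → Set₁
Characterisation {𝕍 = 𝕍} M k s W =
  (length W ≡ 1 → InP M k s ⟦ W ⟧) ×
  (2 ≤ length W → (Z : List 𝕍) → Z ⊆ W → Z ≢ Data.List.[] → ¬ (W ⊆ Z) →
     Σ[ W' ∈ VSet 𝕍 ] (InP M k s W' × Evidence W' ⟦ Z ⟧ (λ x → x ∈ W × x ∉ Z)))

-- Only the closure of 𝒫(s) under extensional equality is used.  The sole
-- evidence of ⟨{w},{w}⟩ is {w}, and W is itself an evidence of ⟨Z, W∖Z⟩ for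
-- every proper nonempty part Z.  Conversely, if |W| ≥ 2 and W is an evidence
-- of ⟨X,Y⟩, then some proper nonempty Z ⊆ W has Z ⊆ X and W∖Z ⊆ Y (take W∩X
-- if W ⊈ X, else W∖Y if W ⊈ Y, else a singleton), and any evidence of
-- ⟨Z, W∖Z⟩ is an evidence of ⟨X,Y⟩.

module Submission where

open import Data.List using (List; []; _∷_; length; filter)
import Data.List.Membership.DecPropositional as DecMembership
open import Data.List.Membership.Propositional using (_∈_; _∉_; find)
open import Data.List.Membership.Propositional.Properties using (∈-filter⁺; ∈-filter⁻)
open import Data.List.Relation.Binary.Subset.Propositional using (_⊆_)
open import Data.List.Relation.Unary.All as All using (all?; _∷_)
open import Data.List.Relation.Unary.All.Properties using (¬All⇒Any¬)
open import Data.List.Relation.Unary.AllPairs using (_∷_)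
open import Data.List.Relation.Unary.Any using (here; there)
open import Data.List.Relation.Unary.Unique.Propositional using (Unique)
open import Data.Nat using (s≤s; z≤n)
open import Data.Nat.Properties using (eq?)
open import Data.Product using (Σ-syntax; ∃-syntax; _×_; _,_; proj₁; proj₂)
open import Data.Sum as Sum using (_⊎_; inj₁; inj₂)
open import Defs
open import Function.Base using (id)
open import Function.Bundles using (_⇔_; mk⇔; mk↣)
import Function.Properties.Equivalence as ⇔
open import Relation.Binary.Definitions using (DecidableEquality)
open import Relation.Binary.PropositionalEquality using (_≡_; _≢_; refl)
open import Relation.Nullary using (¬_; yes; no; contradiction)
open import Relation.Nullary.Decidable using (decidable-stable; toSum)
open import Relation.Unary using (Decidable) renaming (_⊆_ to _⊆ₚ_)

Countable⇒≟ : {A : Set} → Countable A → DecidableEquality A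
Countable⇒≟ (f , f-injective) = eq? (mk↣ f-injective)

InP-resp-≐ : {ℙ 𝕍 : Set} (M : DEM ℙ 𝕍) (k : Kind) (s : DEM.S M) {A B : VSet 𝕍} →
  InP M k s A → A ≐ B → InP M k s B
InP-resp-≐ M global s (u , v , u≈v , v≈s , Δ-finite , Δ≐A) A≐B =
  u , v , u≈v , v≈s , Δ-finite , λ x → ⇔.trans (Δ≐A x) (A≐B x)
InP-resp-≐ M local s (t , t≈s , Δ-finite , Δ≐A) A≐B =
  t , t≈s , Δ-finite , λ x → ⇔.trans (Δ≐A x) (A≐B x)

module _ {𝕍 : Set} where

  ProperPart : List 𝕍 → List 𝕍 → Set
  ProperPart Z W = Z ⊆ W × Z ≢ [] × ¬ (W ⊆ Z)

  ∈⇒≢[] : {x : 𝕍} {xs : List 𝕍} → x ∈ xs → xs ≢ []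
  ∈⇒≢[] () refl

  Evidence-mono : {A X X′ Y Y′ : VSet 𝕍} → X ⊆ₚ X′ → Y ⊆ₚ Y′ →
    Evidence A X Y → Evidence A X′ Y′
  Evidence-mono X⊆X′ Y⊆Y′ ((x , Ax , Xx) , (y , Ay , Yy) , A⊆X∪Y) =
    (x , Ax , X⊆X′ Xx) , (y , Ay , Y⊆Y′ Yy) , λ z Az → Sum.map X⊆X′ Y⊆Y′ (A⊆X∪Y z Az)

  Evidence-singleton⇒≐ : {A : VSet 𝕍} {w : 𝕍} →
    Evidence A ⟦ w ∷ [] ⟧ ⟦ w ∷ [] ⟧ → A ≐ ⟦ w ∷ [] ⟧
  Evidence-singleton⇒≐ ((_ , Aw , here refl) , _ , A⊆w) x =
    mk⇔ (λ Ax → Sum.reduce (A⊆w x Ax)) λ { (here refl) → Aw }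

module DecidableMembership {𝕍 : Set} (_≟_ : DecidableEquality 𝕍) where
  open DecMembership _≟_ using (_∈?_; _∉?_)

  _∖_ : List 𝕍 → List 𝕍 → List 𝕍
  xs ∖ ys = filter (_∉? ys) xs

  ∈-∖⁺ : {x : 𝕍} {xs : List 𝕍} (ys : List 𝕍) → x ∈ xs → x ∉ ys → x ∈ xs ∖ ys
  ∈-∖⁺ ys = ∈-filter⁺ (_∉? ys)

  ∈-∖⁻ : {x : 𝕍} (xs ys : List 𝕍) → x ∈ xs ∖ ys → x ∈ xs × x ∉ ys
  ∈-∖⁻ xs ys = ∈-filter⁻ (_∉? ys) {xs = xs}

  ⊆-or-∃∉ : (xs ys : List 𝕍) → xs ⊆ ys ⊎ ∃[ x ] (x ∈ xs × x ∉ ys)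
  ⊆-or-∃∉ xs ys with all? (_∈? ys) xs
  ... | yes xs⊆ys = inj₁ (All.lookup xs⊆ys)
  ... | no  xs⊈ys = inj₂ (find (¬All⇒Any¬ (_∈? ys) xs xs⊈ys))

  Evidence-∖ : (W Z : List 𝕍) → ProperPart Z W → Evidence ⟦ W ⟧ ⟦ Z ⟧ ⟦ W ∖ Z ⟧
  Evidence-∖ W [] (_ , Z≢[] , _) = contradiction refl Z≢[]
  Evidence-∖ W (z ∷ zs) (Z⊆W , _ , W⊈Z) with ⊆-or-∃∉ W (z ∷ zs)
  ... | inj₁ W⊆Z = contradiction (λ {x} → W⊆Z {x}) W⊈Z
  ... | inj₂ (c , c∈W , c∉Z) =
    (z , Z⊆W (here refl) , here refl) ,
    (c , c∈W , ∈-∖⁺ (z ∷ zs) c∈W c∉Z) ,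
    λ x x∈W → Sum.map₂ (∈-∖⁺ (z ∷ zs) x∈W) (toSum (x ∈? (z ∷ zs)))

  filter-properPart : {P : 𝕍 → Set} (P? : Decidable P) {W : List 𝕍} {a c : 𝕍} →
    a ∈ W → P a → c ∈ W → ¬ P c →
    ProperPart (filter P? W) W
  filter-properPart P? {W} a∈W Pa c∈W ¬Pc =
    (λ x∈Z → proj₁ (∈-filter⁻ P? {xs = W} x∈Z)) ,
    ∈⇒≢[] (∈-filter⁺ P? a∈W Pa) ,
    λ W⊆Z → ¬Pc (proj₂ (∈-filter⁻ P? {xs = W} (W⊆Z c∈W)))

  evidence⇒cut : {W X Y : List 𝕍} {p q : 𝕍} → p ∈ W → q ∈ W → p ≢ q →
    Evidence ⟦ W ⟧ ⟦ X ⟧ ⟦ Y ⟧ →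
    Σ[ Z ∈ List 𝕍 ] (ProperPart Z W × ⟦ Z ⟧ ⊆ₚ ⟦ X ⟧ × (λ x → x ∈ W × x ∉ Z) ⊆ₚ ⟦ Y ⟧)
  evidence⇒cut {W} {X} {Y} {p} p∈W q∈W p≢q ((a , a∈W , a∈X) , (b , b∈W , b∈Y) , W⊆X∪Y)
    with ⊆-or-∃∉ W X | ⊆-or-∃∉ W Y
  ... | inj₂ (c , c∈W , c∉X) | _ =
    filter (_∈? X) W ,
    filter-properPart (_∈? X) a∈W a∈X c∈W c∉X ,
    (λ x∈Z → proj₂ (∈-filter⁻ (_∈? X) {xs = W} x∈Z)) ,
    λ { {x} (x∈W , x∉Z) → Sum.[ (λ x∈X → contradiction (∈-filter⁺ (_∈? X) x∈W x∈X) x∉Z) , id ]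
                                (W⊆X∪Y x x∈W) }
  ... | inj₁ W⊆X | inj₂ (c , c∈W , c∉Y) =
    W ∖ Y ,
    filter-properPart (_∉? Y) c∈W c∉Y b∈W (λ b∉Y → b∉Y b∈Y) ,
    (λ x∈Z → W⊆X (proj₁ (∈-∖⁻ W Y x∈Z))) ,
    λ { {x} (x∈W , x∉Z) → decidable-stable (x ∈? Y) (λ x∉Y → x∉Z (∈-∖⁺ Y x∈W x∉Y)) }
  ... | inj₁ W⊆X | inj₁ W⊆Y =
    p ∷ [] ,
    ((λ { (here refl) → p∈W }) , (λ ()) , λ W⊆p → p≢q (only-p (W⊆p q∈W))) ,
    (λ { (here refl) → W⊆X p∈W }) ,
    λ (x∈W , _) → W⊆Y x∈W
    where
    only-p : {x : 𝕍} → x ∈ p ∷ [] → p ≡ x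
    only-p (here refl) = refl

module _ {ℙ 𝕍 : Set} (_≟_ : DecidableEquality 𝕍) (M : DEM ℙ 𝕍) (k : Kind) (s : DEM.S M) where
  open DecidableMembership _≟_

  generative⇒singleton∈P : (W : List 𝕍) → Generative M k s W → length W ≡ 1 → InP M k s ⟦ W ⟧
  generative⇒singleton∈P (w ∷ []) gen refl =
    let W′ , W′∈P , W′-evidence = gen (w ∷ []) (w ∷ []) w-evidence
    in InP-resp-≐ M k s W′∈P (Evidence-singleton⇒≐ W′-evidence)
    where
    w-evidence : Evidence ⟦ w ∷ [] ⟧ ⟦ w ∷ [] ⟧ ⟦ w ∷ [] ⟧
    w-evidence = (w , here refl , here refl) , (w , here refl , here refl) , λ _ → inj₁

  generative⇒cut-evidenced : (W : List 𝕍) → Generative M k s W → (Z : List 𝕍) → ProperPart Z W →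
    Σ[ W′ ∈ VSet 𝕍 ] (InP M k s W′ × Evidence W′ ⟦ Z ⟧ (λ x → x ∈ W × x ∉ Z))
  generative⇒cut-evidenced W gen Z Z-part =
    let W′ , W′∈P , W′-evidence = gen Z (W ∖ Z) (Evidence-∖ W Z Z-part)
    in W′ , W′∈P , Evidence-mono id (∈-∖⁻ W Z) W′-evidence

  generative⇒characterisation : (W : List 𝕍) → Generative M k s W → Characterisation M k s W
  generative⇒characterisation W gen =
    generative⇒singleton∈P W gen ,
    λ _ Z Z⊆W Z≢[] W⊈Z → generative⇒cut-evidenced W gen Z (Z⊆W , Z≢[] , W⊈Z)

  characterisation⇒generative : (W : List 𝕍) → Unique W → W ≢ [] →
    Characterisation M k s W → Generative M k s W
  characterisation⇒generative [] _ W≢[] _ = contradiction refl W≢[]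
  characterisation⇒generative (w ∷ []) _ _ (singleton∈P , _) X Y W-evidence =
    ⟦ w ∷ [] ⟧ , singleton∈P refl , W-evidence
  characterisation⇒generative (p ∷ q ∷ _) ((p≢q ∷ _) ∷ _) _ (_ , cut-evidenced) X Y W-evidence =
    let Z , (Z⊆W , Z≢[] , W⊈Z) , Z⊆X , W∖Z⊆Y =
          evidence⇒cut (here refl) (there (here refl)) p≢q W-evidence
        W′ , W′∈P , W′-evidence = cut-evidenced (s≤s (s≤s z≤n)) Z Z⊆W Z≢[] W⊈Z
    in W′ , W′∈P , Evidence-mono Z⊆X W∖Z⊆Y W′-evidence

mainTheorem6 : {ℙ 𝕍 : Set} → Countable ℙ → Countable 𝕍 →
    (M : DEM ℙ 𝕍) (s : DEM.S M) (k : Kind) (W : List 𝕍) →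
    Unique W → W ≢ [] →
    Generative M k s W ⇔ Characterisation M k s W
mainTheorem6 {𝕍 = 𝕍} _ 𝕍-countable M s k W W-unique W≢[] =
  mk⇔ (generative⇒characterisation _≟_ M k s W)
      (characterisation⇒generative _≟_ M k s W W-unique W≢[])
  where
  _≟_ : DecidableEquality 𝕍
  _≟_ = Countable⇒≟ 𝕍-countable
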